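{- Define graphs $G_k$ for $k\ge 1$ as follows: $G_1$ is a single vertex; $G_2$ is the graph obtained from a path on four vertices by attaching one additional leaf vertex to one of the two inner vertices of the path (equivalently, $K_{1,3}$ with one edge subdivided by a new vertex); for $k\ge 2$, $G_{k+1}$ is obtained from a complete graph $K_{k+1}$ by (i) for each vertex $v$ of $K_{k+1}$, adding two new vertex-disjoint copies of $G_k$ and joining $v$ to every vertex of both copies, and (ii) for each edge $vw$ of $K_{k+1}$, adding two new vertex-disjoint copies of $G_{k-1}$ and joining both $v$ and $w$ to every vertex of both copies (no other edges are added). Then $\chi_{CF}(G_k)=k$ for every $k\ge1$.
   Context: For a vertex $v$ of a simple graph $G$, $N[v]$ is the set consisting of $v$ and its neighbors. A conflict-free $k$-coloring of $G$ is a map $\chi: V'\to\{1,\dots,k\}$ defined on a subset $V'\subseteq V(G)$ (other vertices uncolored) such that for every $v\in V(G)$ there is $w\in N[v]\cap V'$ whose color is different from the colors of all other vertices in $N[v]\cap V'$. $\chi_{CF}(G)$ denotes the least $k$ for which $G$ has a conflict-free $k$-coloring. -}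

module Defs where

open import Data.Nat using (ℕ; zero; suc; _<_)
open import Data.Fin as F using (Fin; toℕ)
open import Data.Maybe using (Maybe; just; nothing)
open import Data.Product using (Σ; _×_; _,_; proj₁; proj₂; ∃-syntax)
open import Data.Sum using (_⊎_; inj₁; inj₂)
open import Data.Unit using (⊤; tt)
open import Data.Empty using (⊥)
open import Relation.Nullary using (¬_)
open import Relation.Binary.PropositionalEquality using (_≡_; _≢_)

-- A (simple) graph: a vertex type and an adjacency relation.
-- All graphs constructed below are finite, symmetric and irreflexive.
record Graph : Set₁ where
  field
    V : Set
    E : V → V → Set
open Graph public

InN : (G : Graph) → V G → V G → Set
InN G v u = (u ≡ v) ⊎ E G v u

-- A conflict-free k-coloring: a partial map V → {colors 0..k-1}
-- (nothing = uncolored) such that every closed neighbourhood contains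
-- a colored vertex whose color is unique within that neighbourhood.
ConflictFree : (G : Graph) (k : ℕ) → (V G → Maybe (Fin k)) → Set
ConflictFree G k χ =
  ∀ (v : V G) → ∃[ w ] ∃[ c ]
    ( InN G v w × χ w ≡ just c
    × (∀ (u : V G) → InN G v u → u ≢ w → χ u ≢ just c))

CFColorable : Graph → ℕ → Set
CFColorable G k = ∃[ χ ] ConflictFree G k χ

χCF≡ : Graph → ℕ → Set
χCF≡ G k = CFColorable G k × (∀ j → j < k → ¬ CFColorable G j)

Sym : {A : Set} → (A → A → Set) → A → A → Set
Sym R x y = R x y ⊎ R y x

G₁ : Graph
G₁ = record { V = ⊤ ; E = λ _ _ → ⊥ }

-- G₂: path 0-1-2-3 with an extra leaf 4 attached to inner vertex 1
G₂R : Fin 5 → Fin 5 → Set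
G₂R x y = (toℕ x ≡ 0 × toℕ y ≡ 1) ⊎ (toℕ x ≡ 1 × toℕ y ≡ 2)
        ⊎ (toℕ x ≡ 2 × toℕ y ≡ 3) ⊎ (toℕ x ≡ 1 × toℕ y ≡ 4)

G₂ : Graph
G₂ = record { V = Fin 5 ; E = Sym G₂R }

KEdge : ℕ → Set
KEdge m = Σ (Fin m × Fin m) λ p → proj₁ p F.< proj₂ p

-- vertices of the step construction: clique vertices, two copies of A per
-- clique vertex, two copies of B per clique edge
StepV : ℕ → Graph → Graph → Set
StepV m A B = Fin m ⊎ (Fin m × Fin 2 × V A) ⊎ (KEdge m × Fin 2 × V B)

StepR : (m : ℕ) (A B : Graph) → StepV m A B → StepV m A B → Set
StepR m A B (inj₁ i) (inj₁ j) = i ≢ j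
StepR m A B (inj₁ i) (inj₂ (inj₁ (j , c , a))) = i ≡ j
StepR m A B (inj₁ i) (inj₂ (inj₂ (((j , l) , _) , c , b))) = (i ≡ j) ⊎ (i ≡ l)
StepR m A B (inj₂ (inj₁ (i , c , a))) (inj₂ (inj₁ (j , d , a'))) =
  i ≡ j × c ≡ d × E A a a'
StepR m A B (inj₂ (inj₂ (((i , l) , _) , c , b))) (inj₂ (inj₂ (((j , l') , _) , d , b'))) =
  i ≡ j × l ≡ l' × c ≡ d × E B b b'
StepR m A B _ _ = ⊥

-- G_{k+1} from K_{k+1}, A = G_k, B = G_{k-1}  (m = k+1)
Step : ℕ → Graph → Graph → Graph
Step m A B = record { V = StepV m A B ; E = Sym (StepR m A B) }

-- Gpair n = (G_{n+1} , G_{n+2})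
Gpair : ℕ → Graph × Graph
Gpair zero = G₁ , G₂
Gpair (suc n) = proj₂ (Gpair n) , Step (suc (suc (suc n))) (proj₂ (Gpair n)) (proj₁ (Gpair n))

-- G (suc n) = G_{n+1}; G 0 is unused (set to G₁)
G : ℕ → Graph
G zero = G₁
G (suc n) = proj₁ (Gpair n)

-- Upper bound: color one clique vertex of G_{k+1} with a fresh color k, leave the other
-- clique vertices uncolored and color every copy of G_k or G_{k-1} by a conflict-free
-- coloring with the old k colors; the clique vertices never interfere with the copies.
-- Lower bound, given a conflict-free k-coloring of G_{k+1}: if some clique vertex v is
-- uncolored, the unique color c of N[v] lies in at most one of the two copies of G_k at v,
-- so the other copy avoids c and yields a (k-1)-coloring of G_k. Otherwise two of the k+1
-- clique vertices v, w share a color c; the unique color d of N[v] differs from c and lies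
-- in at most one copy of G_{k-1} at vw, and in the other copy neither c (repeated at v and w)
-- nor d (absent) can be unique, so dropping both gives a (k-2)-coloring of G_{k-1}.
module Submission where

open import Defs
open import Data.Nat using (ℕ; zero; suc; _≤_; s≤s)
open import Data.Nat.Properties using (n<1+n; n≤1+n)
import Data.Nat as ℕ
open import Data.Fin as F using (Fin; toℕ; inject₁; inject≤; fromℕ; punchOut)
open import Data.Fin.Properties
  using (punchOut-injective; inject₁-injective; inject≤-injective; fromℕ≢inject₁; pigeonhole; <⇒≢; <-irrelevant)
open import Data.Maybe as Maybe using (Maybe; just; nothing)
open import Data.Maybe.Properties using (just-injective; map-injective)
open import Data.Product using (_×_; _,_; proj₁; proj₂; ∃-syntax)
open import Data.Sum using (_⊎_; inj₁; inj₂; swap)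
open import Data.Sum.Properties using (inj₁-injective)
open import Data.Unit using (tt)
open import Data.Empty using (⊥; ⊥-elim)
open import Function using (_∘_)
open import Function.Definitions using (Injective)
open import Relation.Nullary using (¬_; yes; no)
open import Relation.Nullary.Decidable using (Dec; True; False; toWitness; toWitnessFalse; _⊎-dec_; _×-dec_)
open import Relation.Binary.Definitions using (Symmetric)
open import Relation.Binary.PropositionalEquality using (_≡_; _≢_; refl; sym; trans; cong)

UniqueColorAt : (G : Graph) {k : ℕ} → (V G → Maybe (Fin k)) → V G → V G → Fin k → Set
UniqueColorAt G χ v w c = InN G v w × χ w ≡ just c × (∀ u → InN G v u → u ≢ w → χ u ≢ just c)

ConflictFreeAvoiding : (G : Graph) (k : ℕ) → (V G → Maybe (Fin k)) → Fin k → Set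
ConflictFreeAvoiding G k χ c = ∀ v → ∃[ w ] ∃[ d ] (d ≢ c × UniqueColorAt G χ v w d)

module _ {G : Graph} {k : ℕ} {χ : V G → Maybe (Fin k)} where

  repeatedColor-notUnique : ∀ {v w x y c d} → UniqueColorAt G χ v w d →
    InN G v x → InN G v y → x ≢ y → χ x ≡ just c → χ y ≡ just c → d ≢ c
  repeatedColor-notUnique (_ , _ , unique) x∈ y∈ x≢y χx χy refl =
    unique _ x∈ (λ x≡w → unique _ y∈ (λ y≡w → x≢y (trans x≡w (sym y≡w))) χy) χx

  unusedColor⇒avoiding : ∀ {c} → ConflictFree G k χ → (∀ v → χ v ≢ just c) →
    ConflictFreeAvoiding G k χ c
  unusedColor⇒avoiding {c} cf unused v with cf v
  ... | w , d , u@(_ , χw , _) = w , d , d≢c , u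
    where
    d≢c : d ≢ c
    d≢c refl = unused w χw

recolor : ∀ {G j k} {χ : V G → Maybe (Fin j)} (g : Fin j → Fin k) → Injective _≡_ _≡_ g →
  ConflictFree G j χ → ConflictFree G k (Maybe.map g ∘ χ)
recolor g g-injective cf v with cf v
... | w , d , w∈ , χw , unique =
  w , g d , w∈ , cong (Maybe.map g) χw ,
  λ u u∈ u≢w χu → unique u u∈ u≢w (map-injective g-injective χu)

CFColorable-mono : ∀ {G j k} → j ≤ k → CFColorable G j → CFColorable G k
CFColorable-mono j≤k (χ , cf) = _ , recolor (λ c → inject≤ c j≤k) (inject≤-injective j≤k j≤k _ _) cf

CFColorable-zero : ∀ {G} → V G → ¬ CFColorable G 0
CFColorable-zero v (_ , cf) with cf v
... | _ , () , _

deleteColor : ∀ {m} → Fin (suc m) → Maybe (Fin (suc m)) → Maybe (Fin m)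
deleteColor c nothing = nothing
deleteColor c (just x) with c F.≟ x
... | yes _ = nothing
... | no c≢x = just (punchOut c≢x)

deleteColor-just : ∀ {m} {c x : Fin (suc m)} → c ≢ x →
  ∃[ e ] (deleteColor c (just x) ≡ just e × (∀ y → deleteColor c y ≡ just e → y ≡ just x))
deleteColor-just {c = c} {x} c≢x with c F.≟ x
... | yes c≡x = ⊥-elim (c≢x c≡x)
... | no c≢x′ = punchOut c≢x′ , refl , reflects
  where
  reflects : ∀ y → deleteColor c y ≡ just (punchOut c≢x′) → y ≡ just x
  reflects (just y) eq with c F.≟ y
  ... | no c≢y = cong just (punchOut-injective c≢y c≢x′ (just-injective eq))

module _ {G : Graph} {m : ℕ} {χ : V G → Maybe (Fin (suc m))} {c : Fin (suc m)} where

  deleteColor-conflictFree : ConflictFreeAvoiding G (suc m) χ c → ConflictFree G m (deleteColor c ∘ χ)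
  deleteColor-conflictFree avoid v with avoid v
  ... | w , d , d≢c , w∈ , χw , unique with deleteColor-just (d≢c ∘ sym)
  ... | e , deleted , reflects =
    w , e , w∈ , trans (cong (deleteColor c) χw) deleted ,
    λ u u∈ u≢w χu → unique u u∈ u≢w (reflects (χ u) χu)

  deleteColor-unused : ∀ {d} → c ≢ d → (∀ v → χ v ≢ just d) →
    ∃[ e ] (∀ v → deleteColor c (χ v) ≢ just e)
  deleteColor-unused c≢d unused with deleteColor-just c≢d
  ... | e , _ , reflects = e , λ v χv → unused v (reflects (χ v) χv)

  avoiding⇒CFColorable : ConflictFreeAvoiding G (suc m) χ c → CFColorable G m
  avoiding⇒CFColorable avoid = _ , deleteColor-conflictFree avoid

unusedColor⇒CFColorable : ∀ {G m c} {χ : V G → Maybe (Fin (suc m))} →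
  ConflictFree G (suc m) χ → (∀ v → χ v ≢ just c) → CFColorable G m
unusedColor⇒CFColorable cf unused = avoiding⇒CFColorable (unusedColor⇒avoiding cf unused)

avoidingAndUnused⇒CFColorable : ∀ {G m c d} {χ : V G → Maybe (Fin (suc (suc m)))} →
  ConflictFreeAvoiding G (suc (suc m)) χ c → c ≢ d → (∀ v → χ v ≢ just d) → CFColorable G m
avoidingAndUnused⇒CFColorable {G} {χ = χ} avoid c≢d unused =
  unusedColor⇒CFColorable (deleteColor-conflictFree avoid)
    (proj₂ (deleteColor-unused {G} {χ = χ} c≢d unused))

module _ {A S : Graph} {k : ℕ} (f : V A → V S) (f-injective : ∀ {x y} → f x ≡ f y → x ≡ y)
         (f-InN : ∀ {a u} → InN A a u → InN S (f a) (f u)) where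

  restrict-avoiding : ∀ {χ : V S → Maybe (Fin k)} {c} → ConflictFree S k χ →
    (∀ a {w d} → UniqueColorAt S χ (f a) w d → d ≢ c × ∃[ a′ ] (w ≡ f a′ × InN A a a′)) →
    ConflictFreeAvoiding A k (χ ∘ f) c
  restrict-avoiding cf witness a with cf (f a)
  ... | w , d , u@(_ , χw , unique) with witness a u
  ... | d≢c , a′ , refl , a′∈ =
    a′ , d , d≢c , a′∈ , χw , λ x x∈ x≢a′ → unique (f x) (f-InN x∈) (x≢a′ ∘ f-injective)

Sym-symmetric : ∀ {X : Set} {R : X → X → Set} → Symmetric (Sym R)
Sym-symmetric = swap

module StepGraph (m : ℕ) (A B : Graph) where

  S : Graph
  S = Step m A B

  vertexCopy : Fin m → Fin 2 → V A → V S
  vertexCopy i t a = inj₂ (inj₁ (i , t , a))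

  edgeCopy : KEdge m → Fin 2 → V B → V S
  edgeCopy e t b = inj₂ (inj₂ (e , t , b))

  vertexCopy-injective : ∀ {i t x y} → vertexCopy i t x ≡ vertexCopy i t y → x ≡ y
  vertexCopy-injective refl = refl

  edgeCopy-injective : ∀ {e t x y} → edgeCopy e t x ≡ edgeCopy e t y → x ≡ y
  edgeCopy-injective refl = refl

  InN-clique : ∀ {i l} → i ≢ l → InN S (inj₁ i) (inj₁ l)
  InN-clique i≢l = inj₂ (inj₁ i≢l)

  InN-clique-vertexCopy : ∀ {i t a} → InN S (inj₁ i) (vertexCopy i t a)
  InN-clique-vertexCopy = inj₂ (inj₁ refl)

  InN-clique-edgeCopy : ∀ {i l p t b} → InN S (inj₁ i) (edgeCopy ((i , l) , p) t b)
  InN-clique-edgeCopy = inj₂ (inj₁ (inj₁ refl))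

  InN-edgeCopy-clique : ∀ {i l p t b} →
    InN S (edgeCopy ((i , l) , p) t b) (inj₁ i) × InN S (edgeCopy ((i , l) , p) t b) (inj₁ l)
  InN-edgeCopy-clique = inj₂ (inj₂ (inj₁ refl)) , inj₂ (inj₂ (inj₂ refl))

  vertexCopy-InN⁺ : ∀ {i t a u} → InN A a u → InN S (vertexCopy i t a) (vertexCopy i t u)
  vertexCopy-InN⁺ (inj₁ refl) = inj₁ refl
  vertexCopy-InN⁺ (inj₂ a~u) = inj₂ (inj₁ (refl , refl , a~u))

  edgeCopy-InN⁺ : ∀ {e t b u} → InN B b u → InN S (edgeCopy e t b) (edgeCopy e t u)
  edgeCopy-InN⁺ (inj₁ refl) = inj₁ refl
  edgeCopy-InN⁺ (inj₂ b~u) = inj₂ (inj₁ (refl , refl , refl , b~u))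

  vertexCopy-InN⁻ : Symmetric (E A) → ∀ {i t a} w → InN S (vertexCopy i t a) w →
    w ≡ inj₁ i ⊎ ∃[ a′ ] (w ≡ vertexCopy i t a′ × InN A a a′)
  vertexCopy-InN⁻ symA _ (inj₁ refl) = inj₂ (_ , refl , inj₁ refl)
  vertexCopy-InN⁻ symA (inj₁ j) (inj₂ (inj₂ refl)) = inj₁ refl
  vertexCopy-InN⁻ symA (inj₂ (inj₁ _)) (inj₂ (inj₁ (refl , refl , a~a′))) = inj₂ (_ , refl , inj₂ a~a′)
  vertexCopy-InN⁻ symA (inj₂ (inj₁ _)) (inj₂ (inj₂ (refl , refl , a′~a))) = inj₂ (_ , refl , inj₂ (symA a′~a))

  edgeCopy-InN⁻ : Symmetric (E B) → ∀ {i l p t b} w → InN S (edgeCopy ((i , l) , p) t b) w →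
    w ≡ inj₁ i ⊎ w ≡ inj₁ l ⊎ ∃[ b′ ] (w ≡ edgeCopy ((i , l) , p) t b′ × InN B b b′)
  edgeCopy-InN⁻ symB _ (inj₁ refl) = inj₂ (inj₂ (_ , refl , inj₁ refl))
  edgeCopy-InN⁻ symB (inj₁ j) (inj₂ (inj₂ (inj₁ refl))) = inj₁ refl
  edgeCopy-InN⁻ symB (inj₁ j) (inj₂ (inj₂ (inj₂ refl))) = inj₂ (inj₁ refl)
  edgeCopy-InN⁻ symB {p = p} (inj₂ (inj₂ (((_ , _) , p′) , _ , _))) (inj₂ (inj₁ (refl , refl , refl , b~b′)))
    rewrite <-irrelevant p p′ = inj₂ (inj₂ (_ , refl , inj₂ b~b′))
  edgeCopy-InN⁻ symB {p = p} (inj₂ (inj₂ (((_ , _) , p′) , _ , _))) (inj₂ (inj₂ (refl , refl , refl , b′~b)))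
    rewrite <-irrelevant p p′ = inj₂ (inj₂ (_ , refl , inj₂ (symB b′~b)))

  otherCopy : V S → Fin 2
  otherCopy (inj₂ (inj₁ (_ , F.zero , _))) = F.suc F.zero
  otherCopy (inj₂ (inj₂ (_ , F.zero , _))) = F.suc F.zero
  otherCopy _ = F.zero

  vertexCopy-otherCopy : ∀ w {i a} → vertexCopy i (otherCopy w) a ≢ w
  vertexCopy-otherCopy (inj₂ (inj₁ (_ , F.zero , _))) ()
  vertexCopy-otherCopy (inj₂ (inj₁ (_ , F.suc _ , _))) ()

  edgeCopy-otherCopy : ∀ w {e b} → edgeCopy e (otherCopy w) b ≢ w
  edgeCopy-otherCopy (inj₂ (inj₂ (_ , F.zero , _))) ()
  edgeCopy-otherCopy (inj₂ (inj₂ (_ , F.suc _ , _))) ()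

Step-symmetric : ∀ m A B → Symmetric (E (Step m A B))
Step-symmetric m A B = Sym-symmetric {R = StepR m A B}

module StepUpperBound {m : ℕ} {A B : Graph} (symA : Symmetric (E A)) (symB : Symmetric (E B))
  {χA : V A → Maybe (Fin m)} (cfA : ConflictFree A m χA)
  {χB : V B → Maybe (Fin m)} (cfB : ConflictFree B m χB) where

  open StepGraph (suc m) A B

  χ : V S → Maybe (Fin (suc m))
  χ (inj₁ F.zero) = just (fromℕ m)
  χ (inj₁ (F.suc _)) = nothing
  χ (inj₂ (inj₁ (_ , _ , a))) = Maybe.map inject₁ (χA a)
  χ (inj₂ (inj₂ (_ , _ , b))) = Maybe.map inject₁ (χB b)

  oldColor-notNew : ∀ (y : Maybe (Fin m)) → Maybe.map inject₁ y ≢ just (fromℕ m)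
  oldColor-notNew (just x) eq = fromℕ≢inject₁ (sym (just-injective eq))

  newColor-unique : ∀ u → χ u ≡ just (fromℕ m) → u ≡ inj₁ F.zero
  newColor-unique (inj₁ F.zero) _ = refl
  newColor-unique (inj₂ (inj₁ (_ , _ , a))) eq = ⊥-elim (oldColor-notNew (χA a) eq)
  newColor-unique (inj₂ (inj₂ (_ , _ , b))) eq = ⊥-elim (oldColor-notNew (χB b) eq)

  clique-notOldColor : ∀ i d → χ (inj₁ i) ≢ just (inject₁ d)
  clique-notOldColor F.zero d eq = fromℕ≢inject₁ (just-injective eq)

  oldColor-injective : ∀ {x y : Maybe (Fin m)} → Maybe.map inject₁ x ≡ Maybe.map inject₁ y → x ≡ y
  oldColor-injective = map-injective inject₁-injective

  conflictFree : ConflictFree S (suc m) χ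
  conflictFree (inj₁ F.zero) =
    inj₁ F.zero , fromℕ m , inj₁ refl , refl , λ u _ u≢0 χu → u≢0 (newColor-unique u χu)
  conflictFree (inj₁ (F.suc i)) =
    inj₁ F.zero , fromℕ m , InN-clique (λ ()) , refl , λ u _ u≢0 χu → u≢0 (newColor-unique u χu)
  conflictFree (inj₂ (inj₁ (i , t , a))) with cfA a
  ... | w , d , w∈ , χw , unique =
    vertexCopy i t w , inject₁ d , vertexCopy-InN⁺ w∈ , cong (Maybe.map inject₁) χw , others
    where
    others : ∀ u → InN S (vertexCopy i t a) u → u ≢ vertexCopy i t w → χ u ≢ just (inject₁ d)
    others u u∈ u≢w with vertexCopy-InN⁻ symA u u∈
    ... | inj₁ refl = clique-notOldColor i d
    ... | inj₂ (a′ , refl , a′∈) = unique a′ a′∈ (u≢w ∘ cong (vertexCopy i t)) ∘ oldColor-injective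
  conflictFree (inj₂ (inj₂ (e@((i , l) , _) , t , b))) with cfB b
  ... | w , d , w∈ , χw , unique =
    edgeCopy e t w , inject₁ d , edgeCopy-InN⁺ w∈ , cong (Maybe.map inject₁) χw , others
    where
    others : ∀ u → InN S (edgeCopy e t b) u → u ≢ edgeCopy e t w → χ u ≢ just (inject₁ d)
    others u u∈ u≢w with edgeCopy-InN⁻ symB u u∈
    ... | inj₁ refl = clique-notOldColor i d
    ... | inj₂ (inj₁ refl) = clique-notOldColor l d
    ... | inj₂ (inj₂ (b′ , refl , b′∈)) = unique b′ b′∈ (u≢w ∘ cong (edgeCopy e t)) ∘ oldColor-injective

Step-CFColorable : ∀ {m A B} → Symmetric (E A) → Symmetric (E B) →
  CFColorable A m → CFColorable B m → CFColorable (Step (suc m) A B) (suc m)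
Step-CFColorable symA symB (_ , cfA) (_ , cfB) = _ , StepUpperBound.conflictFree symA symB cfA cfB

module StepLowerBound {n : ℕ} {A B : Graph} (symA : Symmetric (E A)) (symB : Symmetric (E B))
  (A-notColorable : ¬ CFColorable A (suc n)) (B-notColorable : ¬ CFColorable B n)
  {χ : V (Step (suc (suc (suc n))) A B) → Maybe (Fin (suc (suc n)))}
  (cf : ConflictFree (Step (suc (suc (suc n))) A B) (suc (suc n)) χ) where

  open StepGraph (suc (suc (suc n))) A B

  clique-uncolored-impossible : ∀ i → χ (inj₁ i) ≡ nothing → ⊥
  clique-uncolored-impossible i χi with cf (inj₁ i)
  ... | w , c , _ , _ , unique =
    A-notColorable (avoiding⇒CFColorable (restrict-avoiding f vertexCopy-injective vertexCopy-InN⁺ cf witness))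
    where
    f : V A → V S
    f = vertexCopy i (otherCopy w)
    copy-avoids-c : ∀ a → χ (f a) ≢ just c
    copy-avoids-c a = unique (f a) InN-clique-vertexCopy (vertexCopy-otherCopy w)
    witness : ∀ a {w′ d} → UniqueColorAt S χ (f a) w′ d → d ≢ c × ∃[ a′ ] (w′ ≡ f a′ × InN A a a′)
    witness a {w′} (w′∈ , χw′ , _) with vertexCopy-InN⁻ symA w′ w′∈
    ... | inj₁ refl with () ← trans (sym χi) χw′
    ... | inj₂ (a′ , refl , a′∈) = (λ { refl → copy-avoids-c a′ χw′ }) , a′ , refl , a′∈

  clique-colored : ∀ i → ∃[ c ] χ (inj₁ i) ≡ just c
  clique-colored i with χ (inj₁ i) in χi
  ... | just c = c , refl
  ... | nothing = ⊥-elim (clique-uncolored-impossible i χi)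

  clique-sameColor-impossible : ∀ {i l c} → i F.< l → χ (inj₁ i) ≡ just c → χ (inj₁ l) ≡ just c → ⊥
  clique-sameColor-impossible {i} {l} {c} i<l χi χl with cf (inj₁ i)
  ... | w , d , u@(_ , _ , unique) =
    B-notColorable (avoidingAndUnused⇒CFColorable avoid (d≢c ∘ sym) copy-avoids-d)
    where
    i≢l : inj₁ i ≢ inj₁ l
    i≢l = <⇒≢ i<l ∘ inj₁-injective
    d≢c : d ≢ c
    d≢c = repeatedColor-notUnique {S} u (inj₁ refl) (InN-clique (<⇒≢ i<l)) i≢l χi χl
    f : V B → V S
    f = edgeCopy ((i , l) , i<l) (otherCopy w)
    copy-avoids-d : ∀ b → χ (f b) ≢ just d
    copy-avoids-d b = unique (f b) InN-clique-edgeCopy (edgeCopy-otherCopy w)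
    witness : ∀ b {w′ d′} → UniqueColorAt S χ (f b) w′ d′ → d′ ≢ c × ∃[ b′ ] (w′ ≡ f b′ × InN B b b′)
    witness b {w′} {d′} u′@(w′∈ , χw′ , _) = d′≢c , inCopy (edgeCopy-InN⁻ symB w′ w′∈)
      where
      d′≢c : d′ ≢ c
      d′≢c = repeatedColor-notUnique {S} u′ (proj₁ InN-edgeCopy-clique) (proj₂ InN-edgeCopy-clique) i≢l χi χl
      notEnd : ∀ {j} → w′ ≡ inj₁ j → χ (inj₁ j) ≡ just c → ⊥
      notEnd w′≡j χj = d′≢c (just-injective (trans (sym χw′) (trans (cong χ w′≡j) χj)))
      inCopy : w′ ≡ inj₁ i ⊎ w′ ≡ inj₁ l ⊎ ∃[ b′ ] (w′ ≡ f b′ × InN B b b′) → ∃[ b′ ] (w′ ≡ f b′ × InN B b b′)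
      inCopy (inj₁ w′≡i) = ⊥-elim (notEnd w′≡i χi)
      inCopy (inj₂ (inj₁ w′≡l)) = ⊥-elim (notEnd w′≡l χl)
      inCopy (inj₂ (inj₂ inside)) = inside
    avoid : ConflictFreeAvoiding B (suc (suc n)) (χ ∘ f) c
    avoid = restrict-avoiding f edgeCopy-injective edgeCopy-InN⁺ cf witness

  impossible : ⊥
  impossible with pigeonhole (n<1+n (suc (suc n))) (proj₁ ∘ clique-colored)
  ... | i , l , i<l , sameColor =
    clique-sameColor-impossible i<l (proj₂ (clique-colored i))
      (trans (proj₂ (clique-colored l)) (cong just (sym sameColor)))

Step-notCFColorable : ∀ {n A B} → Symmetric (E A) → Symmetric (E B) →
  ¬ CFColorable A (suc n) → ¬ CFColorable B n → ¬ CFColorable (Step (suc (suc (suc n))) A B) (suc (suc n))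
Step-notCFColorable symA symB A-notColorable B-notColorable (_ , cf) =
  StepLowerBound.impossible symA symB A-notColorable B-notColorable cf

G₁-CFColorable : CFColorable G₁ 1
G₁-CFColorable = (λ _ → just F.zero) , λ _ → tt , F.zero , inj₁ refl , refl , λ _ _ u≢tt _ → u≢tt refl

pattern v0 = F.zero
pattern v1 = F.suc F.zero
pattern v2 = F.suc (F.suc F.zero)
pattern v3 = F.suc (F.suc (F.suc F.zero))
pattern v4 = F.suc (F.suc (F.suc (F.suc F.zero)))

G₂R? : ∀ x y → Dec (G₂R x y)
G₂R? x y = ((toℕ x ℕ.≟ 0) ×-dec (toℕ y ℕ.≟ 1)) ⊎-dec ((toℕ x ℕ.≟ 1) ×-dec (toℕ y ℕ.≟ 2))
  ⊎-dec ((toℕ x ℕ.≟ 2) ×-dec (toℕ y ℕ.≟ 3)) ⊎-dec ((toℕ x ℕ.≟ 1) ×-dec (toℕ y ℕ.≟ 4))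

InN-G₂? : ∀ v w → Dec (InN G₂ v w)
InN-G₂? v w = (w F.≟ v) ⊎-dec (G₂R? v w ⊎-dec G₂R? w v)

∈N : ∀ v w {_ : True (InN-G₂? v w)} → InN G₂ v w
∈N v w {v~w} = toWitness v~w

∉N : ∀ v w {_ : False (InN-G₂? v w)} → ¬ InN G₂ v w
∉N v w {v≁w} = toWitnessFalse v≁w

G₂-coloring : Fin 5 → Maybe (Fin 2)
G₂-coloring v1 = just F.zero
G₂-coloring v3 = just (F.suc F.zero)
G₂-coloring _ = nothing

G₂-coloring-v1 : ∀ u → G₂-coloring u ≡ just F.zero → u ≡ v1
G₂-coloring-v1 v1 _ = refl
G₂-coloring-v1 v0 ()
G₂-coloring-v1 v2 ()
G₂-coloring-v1 v3 ()
G₂-coloring-v1 v4 ()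

G₂-coloring-v3 : ∀ u → G₂-coloring u ≡ just (F.suc F.zero) → u ≡ v3
G₂-coloring-v3 v3 _ = refl
G₂-coloring-v3 v0 ()
G₂-coloring-v3 v1 ()
G₂-coloring-v3 v2 ()
G₂-coloring-v3 v4 ()

G₂-CFColorable : CFColorable G₂ 2
G₂-CFColorable = G₂-coloring , conflictFree
  where
  conflictFree : ConflictFree G₂ 2 G₂-coloring
  conflictFree v0 = v1 , F.zero , ∈N v0 v1 , refl , λ u _ u≢v1 χu → u≢v1 (G₂-coloring-v1 u χu)
  conflictFree v1 = v1 , F.zero , ∈N v1 v1 , refl , λ u _ u≢v1 χu → u≢v1 (G₂-coloring-v1 u χu)
  conflictFree v2 = v1 , F.zero , ∈N v2 v1 , refl , λ u _ u≢v1 χu → u≢v1 (G₂-coloring-v1 u χu)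
  conflictFree v3 = v3 , F.suc F.zero , ∈N v3 v3 , refl , λ u _ u≢v3 χu → u≢v3 (G₂-coloring-v3 u χu)
  conflictFree v4 = v1 , F.zero , ∈N v4 v1 , refl , λ u _ u≢v1 χu → u≢v1 (G₂-coloring-v1 u χu)

-- With one color, every closed neighbourhood contains exactly one colored vertex. The leaves
-- v0 and v3 force v0 or v1, and v2 or v3, to be colored; the first option overloads N[v2],
-- the second (with the leaf v4) overloads N[v1].
module G₂-notOneColorable {χ : Fin 5 → Maybe (Fin 1)} (cf : ConflictFree G₂ 1 χ) where

  coloredNeighbour : ∀ v → ∃[ w ] (InN G₂ v w × χ w ≡ just F.zero)
  coloredNeighbour v with cf v
  ... | w , F.zero , w∈ , χw , _ = w , w∈ , χw

  twoColored-impossible : ∀ v {x y} → InN G₂ v x → InN G₂ v y → x ≢ y →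
    χ x ≡ just F.zero → χ y ≡ just F.zero → ⊥
  twoColored-impossible v x∈ y∈ x≢y χx χy with cf v
  ... | _ , F.zero , u = repeatedColor-notUnique {G₂} u x∈ y∈ x≢y χx χy refl

  impossible : ⊥
  impossible with coloredNeighbour v0 | coloredNeighbour v3 | coloredNeighbour v4
  ... | v1 , _ , χv1 | v2 , _ , χv2 | _ = twoColored-impossible v2 (∈N v2 v1) (∈N v2 v2) (λ ()) χv1 χv2
  ... | v1 , _ , χv1 | v3 , _ , χv3 | _ = twoColored-impossible v2 (∈N v2 v1) (∈N v2 v3) (λ ()) χv1 χv3
  ... | v1 , _ , _ | v0 , v0∈ , _ | _ = ∉N v3 v0 v0∈
  ... | v1 , _ , _ | v1 , v1∈ , _ | _ = ∉N v3 v1 v1∈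
  ... | v1 , _ , _ | v4 , v4∈ , _ | _ = ∉N v3 v4 v4∈
  ... | v0 , _ , χv0 | _ | v1 , _ , χv1 = twoColored-impossible v0 (∈N v0 v0) (∈N v0 v1) (λ ()) χv0 χv1
  ... | v0 , _ , χv0 | _ | v4 , _ , χv4 = twoColored-impossible v1 (∈N v1 v0) (∈N v1 v4) (λ ()) χv0 χv4
  ... | v0 , _ , _ | _ | v0 , v0∈ , _ = ∉N v4 v0 v0∈
  ... | v0 , _ , _ | _ | v2 , v2∈ , _ = ∉N v4 v2 v2∈
  ... | v0 , _ , _ | _ | v3 , v3∈ , _ = ∉N v4 v3 v3∈
  ... | v2 , v2∈ , _ | _ | _ = ∉N v0 v2 v2∈
  ... | v3 , v3∈ , _ | _ | _ = ∉N v0 v3 v3∈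
  ... | v4 , v4∈ , _ | _ | _ = ∉N v0 v4 v4∈

G₂-notCFColorable : ¬ CFColorable G₂ 1
G₂-notCFColorable (_ , cf) = G₂-notOneColorable.impossible cf

Gpair-symmetric : ∀ n → Symmetric (E (proj₁ (Gpair n))) × Symmetric (E (proj₂ (Gpair n)))
Gpair-symmetric zero = (λ ()) , Sym-symmetric {R = G₂R}
Gpair-symmetric (suc n) = proj₂ (Gpair-symmetric n) , Step-symmetric _ _ _

Gpair-CFColorable : ∀ n →
  CFColorable (proj₁ (Gpair n)) (suc n) × CFColorable (proj₂ (Gpair n)) (suc (suc n))
Gpair-CFColorable zero = G₁-CFColorable , G₂-CFColorable
Gpair-CFColorable (suc n) with Gpair-CFColorable n | Gpair-symmetric n
... | B-colorable , A-colorable | symB , symA =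
  A-colorable , Step-CFColorable symA symB A-colorable (CFColorable-mono (n≤1+n (suc n)) B-colorable)

Gpair-notCFColorable : ∀ n →
  ¬ CFColorable (proj₁ (Gpair n)) n × ¬ CFColorable (proj₂ (Gpair n)) (suc n)
Gpair-notCFColorable zero = CFColorable-zero {G₁} tt , G₂-notCFColorable
Gpair-notCFColorable (suc n) with Gpair-notCFColorable n | Gpair-symmetric n
... | B-notColorable , A-notColorable | symB , symA =
  A-notColorable , Step-notCFColorable symA symB A-notColorable B-notColorable

lemma2 : ∀ (n : ℕ) → χCF≡ (G (suc n)) (suc n)
lemma2 n = proj₁ (Gpair-CFColorable n) , λ { j (s≤s j≤n) colorable →
  proj₁ (Gpair-notCFColorable n) (CFColorable-mono j≤n colorable) }
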